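{- There exists an absolute constant $c>0$ such that for every sufficiently large positive integer $N$ there exists a finite set $A\subseteq\mathbb{Z}$ with $|A|\le N$ and $|A+A|\le 6|A|$ such that every subset $A'\subseteq A$ with $A'+A=A+A$ satisfies $|A'|\ge Ne^{ -c\sqrt{\log N}}$.
   Context: $X+Y=\{x+y:x\in X,y\in Y\}$. -}

module Defs where

open import Data.Nat using (ℕ; zero; suc; _*_; _≤?_)
open import Data.Integer as ℤ using (ℤ)
open import Data.List using (List; length; deduplicate; cartesianProductWith)
open import Data.List.Relation.Unary.Unique.Propositional using (Unique)
open import Data.List.Membership.Propositional using (_∈_)
open import Data.Product using (_×_)
open import Relation.Nullary using (yes; no)

record FinSetℤ : Set where
  constructor finset
  field
    elems  : List ℤ
    unique : Unique elems
open FinSetℤ public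

∣_∣ : FinSetℤ → ℕ
∣ X ∣ = length (elems X)

_∈ˢ_ : ℤ → FinSetℤ → Set
z ∈ˢ X = z ∈ elems X

_⊆ˢ_ : FinSetℤ → FinSetℤ → Set
X ⊆ˢ Y = ∀ z → z ∈ˢ X → z ∈ˢ Y

sumsetList : FinSetℤ → FinSetℤ → List ℤ
sumsetList X Y = deduplicate ℤ._≟_ (cartesianProductWith ℤ._+_ (elems X) (elems Y))

∣_+ˢ_∣ : FinSetℤ → FinSetℤ → ℕ
∣ X +ˢ Y ∣ = length (sumsetList X Y)

SumsetEq : FinSetℤ → FinSetℤ → FinSetℤ → FinSetℤ → Set
SumsetEq X Y X' Y' =
  (∀ z → z ∈ sumsetList X Y → z ∈ sumsetList X' Y') ×
  (∀ z → z ∈ sumsetList X' Y' → z ∈ sumsetList X Y)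

isqrt-aux : ℕ → ℕ → ℕ
isqrt-aux zero    n = 0
isqrt-aux (suc f) n with suc f * suc f ≤? n
... | yes _ = suc f
... | no  _ = isqrt-aux f n

⌊√_⌋ : ℕ → ℕ
⌊√ n ⌋ = isqrt-aux n n

{-# OPTIONS --safe #-}
-- Take a set V ⊆ [0, M) without nontrivial three-term progressions and put
-- A = [0, M) ∪ (3M + V).  Then A + A lies in three intervals of length 2M, so
-- |A + A| ≤ 6M ≤ 6|A|.  An element 2(3M + v) of A + A cannot use the lower
-- interval, so any representation a' + b of it has both summands in 3M + V, and
-- then a' = 3M + v because V has no progressions: every A' with A' + A = A + A
-- contains 3M + V.  For V take Behrend's set: a point x ∈ [0, k)^d is sent to
-- ‖x‖² + R·(x read in base 2k); if x + y = 2z then ‖x‖² + ‖y‖² ≥ 2‖z‖² by the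
-- parallelogram law, with equality only when x = y = z.  With k = 2^u and
-- d = u + 5 ≈ √(log₂ N) one gets |A| ≤ N and |V| = 2^(ud) ≥ N · 2^(-8d).
module Submission where

open import Defs
open import Data.Nat using (ℕ; zero; suc; _+_; _*_; _^_; _≤_; _<_; _≤?_; _<?_; ∣_-_∣; ⌊_/2⌋; NonZero; >-nonZero; z≤n; s≤s)
open import Data.Nat.Properties
open import Data.Nat.Logarithm using (⌊log₂_⌋; ⌊log₂⌋-mono-≤; ⌊log₂[2^n]⌋≡n)
open import Data.Nat.Logarithm.Core using (⌊log2⌋)
open import Data.Nat.Tactic.RingSolver using (solve-∀)
open import Data.Integer as ℤ using (ℤ)
open import Data.Integer.Properties using (+-injective)
open import Data.Fin using (Fin; toℕ; combine; funToFin; finToFun) renaming (zero to fzero; suc to fsuc)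
open import Data.Fin.Properties using (toℕ<n; toℕ-injective; funToFin-finToFin)
open import Data.Vec.Functional as V using (Vector; head; tail)
open import Data.List using (List; []; _∷_; length; map; upTo; allFin; _++_; cartesianProductWith)
open import Data.List.Properties using (length-map; length-++; length-upTo; length-tabulate; length-removeAt′)
open import Data.List.Membership.Propositional using (_∈_; _─_)
open import Data.List.Membership.Propositional.Properties
  using (∈-map⁺; ∈-map⁻; ∈-++⁺ʳ; ∈-++⁻; ∈-upTo⁺; ∈-upTo⁻; ∈-allFin; ∈-deduplicate⁺; ∈-deduplicate⁻;
         ∈-cartesianProductWith⁺; ∈-cartesianProductWith⁻)
open import Data.List.Relation.Unary.Any using (here; there)
open import Data.List.Relation.Unary.All as All using ()
open import Data.List.Relation.Unary.AllPairs using (_∷_)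
open import Data.List.Relation.Unary.Unique.Propositional using (Unique)
import Data.List.Relation.Unary.Unique.Propositional.Properties as UniqueProp
open import Data.List.Relation.Unary.Unique.DecPropositional.Properties ℤ._≟_ using (deduplicate-!)
open import Data.Product using (Σ; _×_; _,_; proj₁; proj₂; ∃; ∃₂)
open import Data.Sum using (_⊎_; inj₁; inj₂; reduce)
open import Function using (_∘_)
open import Induction.WellFounded using (Acc; acc)
open import Relation.Binary.Definitions using (tri<; tri≈; tri>)
open import Relation.Binary.PropositionalEquality
open import Relation.Nullary using (¬_; yes; no; contradiction)

base-digits-< : ∀ {R a b c e} → a < R → b < e → a + R * b < c + R * e
base-digits-< {R} {a} {b} {c} {e} a<R b<e = begin-strict
  a + R * b  <⟨ +-monoˡ-< (R * b) a<R ⟩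
  R + R * b  ≡⟨ *-suc R b ⟨
  R * suc b  ≤⟨ *-monoʳ-≤ R b<e ⟩
  R * e      ≤⟨ m≤n+m (R * e) c ⟩
  c + R * e  ∎
  where open ≤-Reasoning

base-digits-unique : ∀ {R a b c e} → a < R → c < R → a + R * b ≡ c + R * e → a ≡ c × b ≡ e
base-digits-unique {R} {a} {b} {c} {e} a<R c<R eq with <-cmp b e
... | tri< b<e _ _  = contradiction eq (<⇒≢ (base-digits-< a<R b<e))
... | tri> _ _ e<b  = contradiction (sym eq) (<⇒≢ (base-digits-< c<R e<b))
... | tri≈ _ refl _ = +-cancelʳ-≡ (R * b) a c eq , refl

parallelogram-≤ : ∀ {i j} → i ≤ j → (i + j) * (i + j) + ∣ i - j ∣ * ∣ i - j ∣ ≡ 2 * (i * i + j * j)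
parallelogram-≤ {i} i≤j with t , refl ← m≤n⇒∃[o]m+o≡n i≤j rewrite ∣m-m+n∣≡n i t = identity i t
  where
  identity : ∀ i t → (i + (i + t)) * (i + (i + t)) + t * t ≡ 2 * (i * i + (i + t) * (i + t))
  identity = solve-∀

parallelogram : ∀ i j → (i + j) * (i + j) + ∣ i - j ∣ * ∣ i - j ∣ ≡ 2 * (i * i + j * j)
parallelogram i j with ≤-total i j
... | inj₁ i≤j = parallelogram-≤ i≤j
... | inj₂ j≤i = begin
  (i + j) * (i + j) + ∣ i - j ∣ * ∣ i - j ∣  ≡⟨ cong₂ (λ s t → s * s + t * t) (+-comm i j) (∣-∣-comm i j) ⟩
  (j + i) * (j + i) + ∣ j - i ∣ * ∣ j - i ∣  ≡⟨ parallelogram-≤ j≤i ⟩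
  2 * (j * j + i * i)                        ≡⟨ cong (2 *_) (+-comm (j * j) (i * i)) ⟩
  2 * (i * i + j * j)                        ∎
  where open ≡-Reasoning

fromDigits : ℕ → ∀ {d} → Vector ℕ d → ℕ
fromDigits K {zero}  x = 0
fromDigits K {suc d} x = head x + K * fromDigits K (tail x)

‖_‖² : ∀ {d} → Vector ℕ d → ℕ
‖_‖² {zero}  x = 0
‖_‖² {suc d} x = head x * head x + ‖ tail x ‖²

fromDigits-+ : ∀ K {d} (x y : Vector ℕ d) → fromDigits K (V.zipWith _+_ x y) ≡ fromDigits K x + fromDigits K y
fromDigits-+ K {zero}  x y = refl
fromDigits-+ K {suc d} x y = begin
  (x₀ + y₀) + K * fromDigits K (V.zipWith _+_ (tail x) (tail y))
    ≡⟨ cong (λ s → (x₀ + y₀) + K * s) (fromDigits-+ K (tail x) (tail y)) ⟩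
  (x₀ + y₀) + K * (X + Y)
    ≡⟨ rearrange x₀ y₀ K X Y ⟩
  (x₀ + K * X) + (y₀ + K * Y) ∎
  where
  open ≡-Reasoning
  x₀ = head x
  y₀ = head y
  X = fromDigits K (tail x)
  Y = fromDigits K (tail y)
  rearrange : ∀ a b k s t → (a + b) + k * (s + t) ≡ (a + k * s) + (b + k * t)
  rearrange = solve-∀

fromDigits-* : ∀ K c {d} (x : Vector ℕ d) → fromDigits K (V.map (c *_) x) ≡ c * fromDigits K x
fromDigits-* K c {zero}  x = sym (*-zeroʳ c)
fromDigits-* K c {suc d} x = begin
  c * head x + K * fromDigits K (V.map (c *_) (tail x)) ≡⟨ cong (λ s → c * head x + K * s) (fromDigits-* K c (tail x)) ⟩
  c * head x + K * (c * X)                            ≡⟨ rearrange c (head x) K X ⟩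
  c * (head x + K * X)                                ∎
  where
  open ≡-Reasoning
  X = fromDigits K (tail x)
  rearrange : ∀ c a k s → c * a + k * (c * s) ≡ c * (a + k * s)
  rearrange = solve-∀

fromDigits-injective : ∀ {K d} {x y : Vector ℕ d} → (∀ i → x i < K) → (∀ i → y i < K) →
                       fromDigits K x ≡ fromDigits K y → ∀ i → x i ≡ y i
fromDigits-injective {d = suc d} x<K y<K eq fzero    = proj₁ (base-digits-unique (x<K fzero) (y<K fzero) eq)
fromDigits-injective {d = suc d} x<K y<K eq (fsuc i) =
  fromDigits-injective (x<K ∘ fsuc) (y<K ∘ fsuc) (proj₂ (base-digits-unique (x<K fzero) (y<K fzero) eq)) i

fromDigits-< : ∀ {K d} {x : Vector ℕ d} → (∀ i → x i < K) → fromDigits K x < K ^ d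
fromDigits-< {d = zero}        x<K = s≤s z≤n
fromDigits-< {K} {suc d} {x} x<K = begin-strict
  head x + K * fromDigits K (tail x) <⟨ base-digits-< (x<K fzero) (fromDigits-< (x<K ∘ fsuc)) ⟩
  0 + K * K ^ d                      ≡⟨⟩
  K ^ suc d                          ∎
  where open ≤-Reasoning

‖‖²-≤ : ∀ {b d} {x : Vector ℕ d} → (∀ i → x i ≤ b) → ‖ x ‖² ≤ d * (b * b)
‖‖²-≤ {d = zero}  x≤b = z≤n
‖‖²-≤ {d = suc d} x≤b = +-mono-≤ (*-mono-≤ (x≤b fzero) (x≤b fzero)) (‖‖²-≤ (x≤b ∘ fsuc))

‖‖²≡0⇒≡0 : ∀ {d} {x : Vector ℕ d} → ‖ x ‖² ≡ 0 → ∀ i → x i ≡ 0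
‖‖²≡0⇒≡0 {suc d} {x} eq fzero    = reduce (m*n≡0⇒m≡0∨n≡0 (head x) (m+n≡0⇒m≡0 (head x * head x) eq))
‖‖²≡0⇒≡0 {suc d} {x} eq (fsuc i) = ‖‖²≡0⇒≡0 (m+n≡0⇒n≡0 (head x * head x) eq) i

midpoint-parallelogram : ∀ {i j l} → i + j ≡ 2 * l →
                         2 * (2 * (l * l)) + ∣ i - j ∣ * ∣ i - j ∣ ≡ 2 * (i * i + j * j)
midpoint-parallelogram {i} {j} {l} i+j≡2l = begin
  2 * (2 * (l * l)) + δ * δ  ≡⟨ cong (_+ δ * δ) (double-square l) ⟩
  (2 * l) * (2 * l) + δ * δ  ≡⟨ cong (λ s → s * s + δ * δ) i+j≡2l ⟨
  (i + j) * (i + j) + δ * δ  ≡⟨ parallelogram i j ⟩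
  2 * (i * i + j * j)        ∎
  where
  open ≡-Reasoning
  δ = ∣ i - j ∣
  double-square : ∀ l → 2 * (2 * (l * l)) ≡ (2 * l) * (2 * l)
  double-square = solve-∀

‖‖²-midpoint-parallelogram : ∀ {d} {x y z : Vector ℕ d} → (∀ i → x i + y i ≡ 2 * z i) →
                             2 * (2 * ‖ z ‖²) + ‖ V.zipWith ∣_-_∣ x y ‖² ≡ 2 * (‖ x ‖² + ‖ y ‖²)
‖‖²-midpoint-parallelogram {zero} mid = refl
‖‖²-midpoint-parallelogram {suc d} {x} {y} {z} mid = begin
  2 * (2 * (z₀² + Z)) + (δ₀² + Δ)          ≡⟨ regroup z₀² δ₀² Z Δ ⟩
  (2 * (2 * z₀²) + δ₀²) + (2 * (2 * Z) + Δ) ≡⟨ cong₂ _+_ (midpoint-parallelogram {head x} {head y} {head z} (mid fzero))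
                                                          (‖‖²-midpoint-parallelogram {x = tail x} {tail y} {tail z} (mid ∘ fsuc)) ⟩
  2 * (x₀² + y₀²) + 2 * (X + Y)             ≡⟨ ungroup x₀² y₀² X Y ⟩
  2 * ((x₀² + X) + (y₀² + Y))               ∎
  where
  open ≡-Reasoning
  x₀² = head x * head x
  y₀² = head y * head y
  z₀² = head z * head z
  δ₀² = ∣ head x - head y ∣ * ∣ head x - head y ∣
  X = ‖ tail x ‖²
  Y = ‖ tail y ‖²
  Z = ‖ tail z ‖²
  Δ = ‖ V.zipWith ∣_-_∣ (tail x) (tail y) ‖²
  regroup : ∀ a t b u → 2 * (2 * (a + b)) + (t + u) ≡ (2 * (2 * a) + t) + (2 * (2 * b) + u)
  regroup = solve-∀
  ungroup : ∀ a b s t → 2 * (a + b) + 2 * (s + t) ≡ 2 * ((a + s) + (b + t))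
  ungroup = solve-∀

midpoint-‖‖²-≡⇒≡ : ∀ {d} {x y z : Vector ℕ d} → (∀ i → x i + y i ≡ 2 * z i) →
                   ‖ x ‖² + ‖ y ‖² ≡ 2 * ‖ z ‖² → ∀ i → x i ≡ z i
midpoint-‖‖²-≡⇒≡ {x = x} {y} {z} mid eq i = *-cancelˡ-≡ (x i) (z i) 2 (begin
  2 * x i     ≡⟨ cong (x i +_) (trans (+-identityʳ (x i)) xᵢ≡yᵢ) ⟩
  x i + y i   ≡⟨ mid i ⟩
  2 * z i     ∎)
  where
  open ≡-Reasoning
  Δ≡0 : ‖ V.zipWith ∣_-_∣ x y ‖² ≡ 0
  Δ≡0 = +-cancelˡ-≡ (2 * (2 * ‖ z ‖²)) _ 0 (begin
    2 * (2 * ‖ z ‖²) + ‖ V.zipWith ∣_-_∣ x y ‖² ≡⟨ ‖‖²-midpoint-parallelogram mid ⟩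
    2 * (‖ x ‖² + ‖ y ‖²)                    ≡⟨ cong (2 *_) eq ⟩
    2 * (2 * ‖ z ‖²)                         ≡⟨ +-identityʳ _ ⟨
    2 * (2 * ‖ z ‖²) + 0                     ∎)
  xᵢ≡yᵢ : x i ≡ y i
  xᵢ≡yᵢ = ∣m-n∣≡0⇒m≡n (‖‖²≡0⇒≡0 Δ≡0 i)

funToFin-cong : ∀ {m n} {f g : Fin m → Fin n} → (∀ i → f i ≡ g i) → funToFin f ≡ funToFin g
funToFin-cong {zero}  f≗g = refl
funToFin-cong {suc m} f≗g = cong₂ combine (f≗g fzero) (funToFin-cong (f≗g ∘ fsuc))

finToFun-injective : ∀ {m n} (a c : Fin (n ^ m)) → (∀ i → finToFun a i ≡ finToFun c i) → a ≡ c
finToFun-injective {m} {n} a c eq = begin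
  a                             ≡⟨ funToFin-finToFin {m} {n} a ⟨
  funToFin {m} {n} (finToFun a) ≡⟨ funToFin-cong {m} {n} eq ⟩
  funToFin {m} {n} (finToFun c) ≡⟨ funToFin-finToFin {m} {n} c ⟩
  c                             ∎
  where open ≡-Reasoning

ThreeAPFree : ∀ {n} → (Fin n → ℕ) → Set
ThreeAPFree v = ∀ a b c → v a + v b ≡ 2 * v c → a ≡ c

module Behrend (k d R : ℕ) (R-large : 2 * (d * (k * k)) < R) where

  digits : Fin (k ^ d) → Vector ℕ d
  digits t i = toℕ (finToFun t i)

  -- Base 2k leaves room for a sum of two points without carries, and R exceeds
  -- the sum of two norms, so behrend a + behrend b ≡ 2 * behrend c splits into
  -- the norm digit and every coordinate separately.
  behrend : Fin (k ^ d) → ℕ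
  behrend t = ‖ digits t ‖² + R * fromDigits (2 * k) (digits t)

  digits<k : ∀ t i → digits t i < k
  digits<k t i = toℕ<n (finToFun t i)

  digits-injective : ∀ a c → (∀ i → digits a i ≡ digits c i) → a ≡ c
  digits-injective a c eq = finToFun-injective {d} {k} a c (λ i → toℕ-injective (eq i))

  ‖digits‖²-≤ : ∀ t → ‖ digits t ‖² ≤ d * (k * k)
  ‖digits‖²-≤ t = ‖‖²-≤ (λ i → <⇒≤ (digits<k t i))

  behrend-< : ∀ t → behrend t < R * (2 * k) ^ d
  behrend-< t = base-digits-< {R} {c = 0}
    (≤-<-trans (‖digits‖²-≤ t) (≤-<-trans (m≤m+n _ _) R-large))
    (fromDigits-< (λ i → ≤-trans (digits<k t i) (m≤m+n k (k + 0))))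

  behrend-3APFree : ThreeAPFree behrend
  behrend-3APFree a b c eq = digits-injective a c (midpoint-‖‖²-≡⇒≡ digitwise-midpoint norms-midpoint)
    where
    x = digits a
    y = digits b
    z = digits c
    K = 2 * k
    split : (‖ x ‖² + ‖ y ‖²) + R * (fromDigits K x + fromDigits K y) ≡ 2 * ‖ z ‖² + R * (2 * fromDigits K z)
    split = begin
      (‖ x ‖² + ‖ y ‖²) + R * (fromDigits K x + fromDigits K y) ≡⟨ regroup ‖ x ‖² ‖ y ‖² R (fromDigits K x) (fromDigits K y) ⟩
      behrend a + behrend b                                    ≡⟨ eq ⟩
      2 * behrend c                                            ≡⟨ distribute ‖ z ‖² R (fromDigits K z) ⟩
      2 * ‖ z ‖² + R * (2 * fromDigits K z)                    ∎
      where
      open ≡-Reasoning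
      regroup : ∀ p q r s t → (p + q) + r * (s + t) ≡ (p + r * s) + (q + r * t)
      regroup = solve-∀
      distribute : ∀ p r s → 2 * (p + r * s) ≡ 2 * p + r * (2 * s)
      distribute = solve-∀
    low-digits-< : ‖ x ‖² + ‖ y ‖² < R
    low-digits-< = ≤-<-trans (+-mono-≤ (‖digits‖²-≤ a) (≤-trans (‖digits‖²-≤ b) (m≤m+n _ 0))) R-large
    digits-midpoint : ‖ x ‖² + ‖ y ‖² ≡ 2 * ‖ z ‖² × fromDigits K x + fromDigits K y ≡ 2 * fromDigits K z
    digits-midpoint = base-digits-unique low-digits-< (≤-<-trans (*-monoʳ-≤ 2 (‖digits‖²-≤ c)) R-large) split
    norms-midpoint : ‖ x ‖² + ‖ y ‖² ≡ 2 * ‖ z ‖²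
    norms-midpoint = proj₁ digits-midpoint
    digitwise-midpoint : ∀ i → x i + y i ≡ 2 * z i
    digitwise-midpoint = fromDigits-injective {K} {x = V.zipWith _+_ x y} {y = V.map (2 *_) z}
      (λ i → +-mono-< (digits<k a i) (<-≤-trans (digits<k b i) (m≤m+n k 0)))
      (λ i → *-monoʳ-< 2 (digits<k c i))
      (begin
        fromDigits K (V.zipWith _+_ x y) ≡⟨ fromDigits-+ K x y ⟩
        fromDigits K x + fromDigits K y ≡⟨ proj₂ digits-midpoint ⟩
        2 * fromDigits K z              ≡⟨ fromDigits-* K 2 z ⟨
        fromDigits K (V.map (2 *_) z)   ∎)
      where open ≡-Reasoning

module _ {A : Set} where

  ∈-─⁺ : ∀ {x y : A} {ys} → x ≢ y → (p : x ∈ ys) → y ∈ ys → y ∈ ys ─ p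
  ∈-─⁺ x≢y (here refl) (here refl) = contradiction refl x≢y
  ∈-─⁺ x≢y (here _)    (there q)   = q
  ∈-─⁺ x≢y (there p)   (here refl) = here refl
  ∈-─⁺ x≢y (there p)   (there q)   = there (∈-─⁺ x≢y p q)

  unique-⊆⇒length-≤ : ∀ {xs ys : List A} → Unique xs → (∀ {z} → z ∈ xs → z ∈ ys) → length xs ≤ length ys
  unique-⊆⇒length-≤ {[]}     _          _   = z≤n
  unique-⊆⇒length-≤ {x ∷ xs} {ys} (x∉xs ∷ xs!) xs⊆ys = begin
    suc (length xs)           ≤⟨ s≤s (unique-⊆⇒length-≤ xs! xs⊆ys─x) ⟩
    suc (length (ys ─ x∈ys))  ≡⟨ length-removeAt′ ys _ ⟨
    length ys                 ∎
    where
    open ≤-Reasoning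
    x∈ys : x ∈ ys
    x∈ys = xs⊆ys (here refl)
    xs⊆ys─x : ∀ {z} → z ∈ xs → z ∈ ys ─ x∈ys
    xs⊆ys─x z∈xs = ∈-─⁺ (All.lookup x∉xs z∈xs) x∈ys (xs⊆ys (there z∈xs))

length-cartesianProductWith : ∀ {A B C : Set} (f : A → B → C) xs ys →
                              length (cartesianProductWith f xs ys) ≡ length xs * length ys
length-cartesianProductWith f []       ys = refl
length-cartesianProductWith f (x ∷ xs) ys = begin
  length (map (f x) ys ++ cartesianProductWith f xs ys)
    ≡⟨ length-++ (map (f x) ys) ⟩
  length (map (f x) ys) + length (cartesianProductWith f xs ys)
    ≡⟨ cong₂ _+_ (length-map (f x) ys) (length-cartesianProductWith f xs ys) ⟩
  length ys + length xs * length ys ∎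
  where open ≡-Reasoning

∈-sumset⁺ : ∀ {X Y x y} → x ∈ˢ X → y ∈ˢ Y → x ℤ.+ y ∈ sumsetList X Y
∈-sumset⁺ x∈X y∈Y = ∈-deduplicate⁺ ℤ._≟_ (∈-cartesianProductWith⁺ ℤ._+_ x∈X y∈Y)

∈-sumset⁻ : ∀ {X Y z} → z ∈ sumsetList X Y → ∃₂ λ x y → x ∈ˢ X × y ∈ˢ Y × z ≡ x ℤ.+ y
∈-sumset⁻ {X} {Y} z∈X+Y = ∈-cartesianProductWith⁻ ℤ._+_ (elems X) (elems Y) (∈-deduplicate⁻ ℤ._≟_ _ z∈X+Y)

module Construction {n} (M : ℕ) (v : Fin n → ℕ) (v<M : ∀ t → v t < M) (v-3APFree : ThreeAPFree v) where

  lift : Fin n → ℕ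
  lift t = 3 * M + v t

  lift-injective : ∀ {a b} → lift a ≡ lift b → a ≡ b
  lift-injective {a} {b} eq = v-3APFree a a b (begin
    v a + v a      ≡⟨ cong₂ _+_ va≡vb va≡vb ⟩
    v b + v b      ≡⟨ cong (v b +_) (+-identityʳ (v b)) ⟨
    2 * v b        ∎)
    where
    open ≡-Reasoning
    va≡vb : v a ≡ v b
    va≡vb = +-cancelˡ-≡ (3 * M) (v a) (v b) eq

  elementsℕ : List ℕ
  elementsℕ = upTo M ++ map lift (allFin n)

  InA : ℕ → Set
  InA x = x < M ⊎ ∃ λ t → x ≡ lift t

  A : FinSetℤ
  A = finset (map ℤ.+_ elementsℕ) (UniqueProp.map⁺ +-injective elements-unique)
    where
    disjoint : ∀ {x} → ¬ (x ∈ upTo M × x ∈ map lift (allFin n))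
    disjoint (x<M , x∈lifts) with t , _ , refl ← ∈-map⁻ lift x∈lifts =
      <-irrefl refl (<-≤-trans (∈-upTo⁻ x<M) (≤-trans (m≤m+n M (2 * M)) (m≤m+n (3 * M) (v t))))
    elements-unique : Unique elementsℕ
    elements-unique = UniqueProp.++⁺ (UniqueProp.upTo⁺ M) (UniqueProp.map⁺ lift-injective (UniqueProp.allFin⁺ n)) disjoint

  ∣A∣≡ : ∣ A ∣ ≡ M + n
  ∣A∣≡ = begin
    length (map ℤ.+_ elementsℕ)                    ≡⟨ length-map ℤ.+_ elementsℕ ⟩
    length (upTo M ++ map lift (allFin n))         ≡⟨ length-++ (upTo M) ⟩
    length (upTo M) + length (map lift (allFin n)) ≡⟨ cong₂ _+_ (length-upTo M) (length-map lift (allFin n)) ⟩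
    M + length (allFin n)                          ≡⟨ cong (M +_) (length-tabulate _) ⟩
    M + n                                          ∎
    where open ≡-Reasoning

  ∈A⇒InA : ∀ {z} → z ∈ˢ A → ∃ λ x → z ≡ ℤ.+ x × InA x
  ∈A⇒InA z∈A with x , x∈elems , refl ← ∈-map⁻ ℤ.+_ z∈A with ∈-++⁻ (upTo M) x∈elems
  ... | inj₁ x∈upTo = x , refl , inj₁ (∈-upTo⁻ x∈upTo)
  ... | inj₂ x∈lifts with t , _ , x≡lift ← ∈-map⁻ lift x∈lifts = x , refl , inj₂ (t , x≡lift)

  lift∈A : ∀ t → (ℤ.+ lift t) ∈ˢ A
  lift∈A t = ∈-map⁺ ℤ.+_ (∈-++⁺ʳ (upTo M) (∈-map⁺ lift (∈-allFin t)))

  block : ℕ → ℕ → ℕ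
  block j r = j * (3 * M) + r

  InA⇒block : ∀ {x} → InA x → ∃₂ λ j r → j < 2 × r < M × x ≡ block j r
  InA⇒block {x} (inj₁ x<M)    = 0 , x , s≤s z≤n , x<M , refl
  InA⇒block (inj₂ (t , refl)) = 1 , v t , s≤s (s≤s z≤n) , v<M t , cong (_+ v t) (sym (*-identityˡ (3 * M)))

  block-+ : ∀ j₁ r₁ j₂ r₂ → block j₁ r₁ + block j₂ r₂ ≡ block (j₁ + j₂) (r₁ + r₂)
  block-+ j₁ r₁ j₂ r₂ = regroup j₁ r₁ j₂ r₂ (3 * M)
    where
    regroup : ∀ j₁ r₁ j₂ r₂ s → (j₁ * s + r₁) + (j₂ * s + r₂) ≡ (j₁ + j₂) * s + (r₁ + r₂)
    regroup = solve-∀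

  blocks : List ℕ
  blocks = cartesianProductWith block (upTo 3) (upTo (2 * M))

  InA+InA∈blocks : ∀ {x y} → InA x → InA y → x + y ∈ blocks
  InA+InA∈blocks Ix Iy with j₁ , r₁ , j₁<2 , r₁<M , refl ← InA⇒block Ix | j₂ , r₂ , j₂<2 , r₂<M , refl ← InA⇒block Iy
    = subst (_∈ blocks) (sym (block-+ j₁ r₁ j₂ r₂))
        (∈-cartesianProductWith⁺ block (∈-upTo⁺ (+-mono-≤ j₁<2 (≤-pred j₂<2)))
                                       (∈-upTo⁺ (+-mono-< r₁<M (<-≤-trans r₂<M (m≤m+n M 0)))))

  ∣A+A∣≤6∣A∣ : ∣ A +ˢ A ∣ ≤ 6 * ∣ A ∣
  ∣A+A∣≤6∣A∣ = begin
    length (sumsetList A A)                 ≤⟨ unique-⊆⇒length-≤ (deduplicate-! _) A+A⊆blocks ⟩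
    length (map ℤ.+_ blocks)                ≡⟨ length-map ℤ.+_ blocks ⟩
    length blocks                           ≡⟨ length-cartesianProductWith block (upTo 3) (upTo (2 * M)) ⟩
    length (upTo 3) * length (upTo (2 * M)) ≡⟨ cong₂ _*_ (length-upTo 3) (length-upTo (2 * M)) ⟩
    3 * (2 * M)                             ≡⟨ *-assoc 3 2 M ⟨
    6 * M                                   ≤⟨ *-monoʳ-≤ 6 (m≤m+n M n) ⟩
    6 * (M + n)                             ≡⟨ cong (6 *_) ∣A∣≡ ⟨
    6 * ∣ A ∣                               ∎
    where
    open ≤-Reasoning
    A+A⊆blocks : ∀ {z} → z ∈ sumsetList A A → z ∈ map ℤ.+_ blocks
    A+A⊆blocks z∈A+A with a , b , a∈A , b∈A , refl ← ∈-sumset⁻ {A} {A} z∈A+A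
                     with x , refl , Ix ← ∈A⇒InA a∈A | y , refl , Iy ← ∈A⇒InA b∈A
      = ∈-map⁺ ℤ.+_ (InA+InA∈blocks Ix Iy)

  InA-< : ∀ {x} → InA x → x < 3 * M + M
  InA-< (inj₁ x<M)       = <-≤-trans x<M (m≤n+m M (3 * M))
  InA-< (inj₂ (t , refl)) = +-monoʳ-< (3 * M) (v<M t)

  low+InA-< : ∀ {x y} → x < M → InA y → x + y < 3 * M + 3 * M
  low+InA-< {x} {y} x<M Iy = begin-strict
    x + y                   <⟨ +-mono-< x<M (InA-< Iy) ⟩
    M + (3 * M + M)         ≤⟨ m≤m+n _ M ⟩
    M + (3 * M + M) + M     ≡⟨ regroup M ⟩
    3 * M + 3 * M           ∎
    where
    open ≤-Reasoning
    regroup : ∀ M → M + (3 * M + M) + M ≡ 3 * M + 3 * M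
    regroup = solve-∀

  lift+lift-≥ : ∀ t → 3 * M + 3 * M ≤ lift t + lift t
  lift+lift-≥ t = +-mono-≤ (m≤m+n (3 * M) (v t)) (m≤m+n (3 * M) (v t))

  double-lift-unique : ∀ t {x y} → InA x → InA y → x + y ≡ lift t + lift t → x ≡ lift t
  double-lift-unique t (inj₁ x<M) Iy eq =
    contradiction eq (<⇒≢ (<-≤-trans (low+InA-< x<M Iy) (lift+lift-≥ t)))
  double-lift-unique t {x} {y} Ix (inj₁ y<M) eq =
    contradiction (trans (+-comm y x) eq) (<⇒≢ (<-≤-trans (low+InA-< y<M Ix) (lift+lift-≥ t)))
  double-lift-unique t (inj₂ (a , refl)) (inj₂ (b , refl)) eq = cong lift (v-3APFree a b t (begin
    v a + v b      ≡⟨ +-cancelˡ-≡ (3 * M + 3 * M) _ _ upper-eq ⟩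
    v t + v t      ≡⟨ cong (v t +_) (+-identityʳ (v t)) ⟨
    2 * v t        ∎))
    where
    open ≡-Reasoning
    regroup : ∀ s p q → (s + p) + (s + q) ≡ (s + s) + (p + q)
    regroup = solve-∀
    upper-eq : (3 * M + 3 * M) + (v a + v b) ≡ (3 * M + 3 * M) + (v t + v t)
    upper-eq = trans (sym (regroup (3 * M) (v a) (v b))) (trans eq (regroup (3 * M) (v t) (v t)))

  covering-subset-≥ : ∀ A' → A' ⊆ˢ A → SumsetEq A' A A A → n ≤ ∣ A' ∣
  covering-subset-≥ A' A'⊆A (_ , A+A⊆A'+A) = begin
    n                                     ≡⟨ trans (length-map (ℤ.+_ ∘ lift) (allFin n)) (length-tabulate _) ⟨
    length (map (ℤ.+_ ∘ lift) (allFin n)) ≤⟨ unique-⊆⇒length-≤ lifts-unique lifts⊆A' ⟩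
    ∣ A' ∣                                ∎
    where
    open ≤-Reasoning
    lifts-unique : Unique (map (ℤ.+_ ∘ lift) (allFin n))
    lifts-unique = UniqueProp.map⁺ (lift-injective ∘ +-injective) (UniqueProp.allFin⁺ n)
    lift∈A' : ∀ t → (ℤ.+ lift t) ∈ˢ A'
    lift∈A' t with a' , b , a'∈A' , b∈A , eq ← ∈-sumset⁻ {A'} {A} (A+A⊆A'+A _ (∈-sumset⁺ {A} {A} (lift∈A t) (lift∈A t)))
              with x , refl , Ix ← ∈A⇒InA (A'⊆A a' a'∈A') | y , refl , Iy ← ∈A⇒InA b∈A
      = subst (λ w → (ℤ.+ w) ∈ˢ A') (double-lift-unique t Ix Iy (sym (+-injective eq))) a'∈A'
    lifts⊆A' : ∀ {z} → z ∈ map (ℤ.+_ ∘ lift) (allFin n) → z ∈ elems A'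
    lifts⊆A' z∈lifts with t , _ , refl ← ∈-map⁻ (ℤ.+_ ∘ lift) z∈lifts = lift∈A' t

n<2^n : ∀ n → n < 2 ^ n
n<2^n zero    = s≤s z≤n
n<2^n (suc n) = +-mono-≤-< (m^n>0 2 n) (<-≤-trans (n<2^n n) (m≤m+n (2 ^ n) 0))

2^m≤n⇒m≤⌊log₂n⌋ : ∀ {m n} → 2 ^ m ≤ n → m ≤ ⌊log₂ n ⌋
2^m≤n⇒m≤⌊log₂n⌋ {m} 2^m≤n = subst (_≤ _) (⌊log₂[2^n]⌋≡n m) (⌊log₂⌋-mono-≤ 2^m≤n)

n<2^suc⌊log₂n⌋ : ∀ n → n < 2 ^ suc ⌊log₂ n ⌋
n<2^suc⌊log₂n⌋ n with n <? 2 ^ suc ⌊log₂ n ⌋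
... | yes n<2^ = n<2^
... | no  n≮2^ = contradiction (2^m≤n⇒m≤⌊log₂n⌋ (≮⇒≥ n≮2^)) 1+n≰n

2^⌊log2⌋≤ : ∀ n (rec : Acc _<_ n) → .{{NonZero n}} → 2 ^ ⌊log2⌋ n rec ≤ n
2^⌊log2⌋≤ 1             _        = s≤s z≤n
2^⌊log2⌋≤ (suc (suc m)) (acc rs) = begin
  2 * 2 ^ ⌊log2⌋ (suc h) _  ≤⟨ *-monoʳ-≤ 2 (2^⌊log2⌋≤ (suc h) _) ⟩
  2 * suc h                 ≡⟨ double-suc h ⟩
  suc (suc (h + h))         ≤⟨ s≤s (s≤s h+h≤m) ⟩
  suc (suc m)               ∎
  where
  open ≤-Reasoning
  h = ⌊ m /2⌋
  double-suc : ∀ h → 2 * suc h ≡ suc (suc (h + h))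
  double-suc = solve-∀
  h+h≤m : h + h ≤ m
  h+h≤m = ≤-trans (+-monoʳ-≤ h (⌊n/2⌋≤⌈n/2⌉ m)) (≤-reflexive (⌊n/2⌋+⌈n/2⌉≡n m))

2^⌊log₂n⌋≤n : ∀ n .{{_ : NonZero n}} → 2 ^ ⌊log₂ n ⌋ ≤ n
2^⌊log₂n⌋≤n n = 2^⌊log2⌋≤ n _

isqrt-aux-spec : ∀ f n → n < suc f * suc f →
                 isqrt-aux f n * isqrt-aux f n ≤ n × n < suc (isqrt-aux f n) * suc (isqrt-aux f n)
isqrt-aux-spec zero    n n<1 = z≤n , n<1
isqrt-aux-spec (suc f) n n<[2+f]² with suc f * suc f ≤? n
... | yes [1+f]²≤n = [1+f]²≤n , n<[2+f]²
... | no  [1+f]²≰n = isqrt-aux-spec f n (≰⇒> [1+f]²≰n)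

⌊√n⌋²≤n : ∀ n → ⌊√ n ⌋ * ⌊√ n ⌋ ≤ n
⌊√n⌋²≤n n = proj₁ (isqrt-aux-spec n n (s≤s (m≤m+n n _)))

n<[1+⌊√n⌋]² : ∀ n → n < suc ⌊√ n ⌋ * suc ⌊√ n ⌋
n<[1+⌊√n⌋]² n = proj₂ (isqrt-aux-spec n n (s≤s (m≤m+n n _)))

m²≤n⇒m≤⌊√n⌋ : ∀ {m n} → m * m ≤ n → m ≤ ⌊√ n ⌋
m²≤n⇒m≤⌊√n⌋ {m} {n} m²≤n with m ≤? ⌊√ n ⌋
... | yes m≤√n = m≤√n
... | no  m≰√n = contradiction (≤-trans (*-mono-≤ (≰⇒> m≰√n) (≰⇒> m≰√n)) m²≤n) (<⇒≱ (n<[1+⌊√n⌋]² n))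

SmallDoublingLargeCovers : ℕ → ℕ → Set
SmallDoublingLargeCovers N e =
  Σ FinSetℤ λ A → ∣ A ∣ ≤ N × ∣ A +ˢ A ∣ ≤ 6 * ∣ A ∣ ×
    (∀ (A' : FinSetℤ) → A' ⊆ˢ A → SumsetEq A' A A A → N ≤ ∣ A' ∣ * 2 ^ e)

size-exponent-≤ : ∀ u → suc (suc ((5 + u) + (u + u)) + suc u * (5 + u)) ≤ (5 + u) * (5 + u)
size-exponent-≤ u = ≤-trans (m≤m+n _ (13 + u)) (≤-reflexive (sym (slack u)))
  where
  slack : ∀ u → (5 + u) * (5 + u) ≡ suc (suc ((5 + u) + (u + u)) + suc u * (5 + u)) + (13 + u)
  slack = solve-∀

loss-exponent-≤ : ∀ u → (6 + u) * (6 + u) ≤ u * (5 + u) + 8 * (5 + u)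
loss-exponent-≤ u = ≤-trans (m≤m+n _ (4 + u)) (≤-reflexive (slack u))
  where
  slack : ∀ u → (6 + u) * (6 + u) + (4 + u) ≡ u * (5 + u) + 8 * (5 + u)
  slack = solve-∀

construction-at-scale : ∀ {s} N → 5 ≤ s → 2 ^ (s * s) ≤ N → N < 2 ^ (suc s * suc s) →
                        SmallDoublingLargeCovers N (8 * s)
construction-at-scale N 5≤s lo hi with u , refl ← m≤n⇒∃[o]m+o≡n 5≤s = A , ∣A∣≤N , ∣A+A∣≤6∣A∣ , covers-large
  where
  d = 5 + u
  k = 2 ^ u
  R = 2 ^ suc (d + (u + u))
  M = R * (2 * k) ^ d

  R-large : 2 * (d * (k * k)) < R
  R-large = begin-strict
    2 * (d * (k * k))          <⟨ *-monoʳ-< 2 (*-monoˡ-< (k * k) {{m*n≢0 k k {{m^n≢0 2 u}} {{m^n≢0 2 u}}}} (n<2^n d)) ⟩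
    2 * (2 ^ d * (k * k))      ≡⟨ cong (λ e → 2 * (2 ^ d * e)) (^-distribˡ-+-* 2 u u) ⟨
    2 * (2 ^ d * 2 ^ (u + u))  ≡⟨ cong (2 *_) (^-distribˡ-+-* 2 d (u + u)) ⟨
    R                          ∎
    where open ≤-Reasoning

  open Behrend k d R R-large
  open Construction M behrend behrend-< behrend-3APFree

  M≡2^ : M ≡ 2 ^ (suc (d + (u + u)) + suc u * d)
  M≡2^ = trans (cong (R *_) (^-*-assoc 2 (suc u) d)) (sym (^-distribˡ-+-* 2 (suc (d + (u + u))) (suc u * d)))

  ∣A∣≤N : ∣ A ∣ ≤ N
  ∣A∣≤N = begin
    ∣ A ∣                                      ≡⟨ ∣A∣≡ ⟩
    M + k ^ d                                  ≤⟨ +-monoʳ-≤ M (≤-trans k^d≤M (m≤m+n M 0)) ⟩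
    2 * M                                      ≡⟨ cong (2 *_) M≡2^ ⟩
    2 ^ suc (suc (d + (u + u)) + suc u * d)    ≤⟨ ^-monoʳ-≤ 2 (size-exponent-≤ u) ⟩
    2 ^ (d * d)                                ≤⟨ lo ⟩
    N                                          ∎
    where
    open ≤-Reasoning
    k^d≤M : k ^ d ≤ M
    k^d≤M = ≤-trans (^-monoˡ-≤ d (m≤m+n k (k + 0))) (m≤n*m _ R {{m^n≢0 2 (suc (d + (u + u)))}})

  covers-large : ∀ A' → A' ⊆ˢ A → SumsetEq A' A A A → N ≤ ∣ A' ∣ * 2 ^ (8 * d)
  covers-large A' A'⊆A A'+A≡A+A = begin
    N                          ≤⟨ <⇒≤ hi ⟩
    2 ^ (suc d * suc d)        ≤⟨ ^-monoʳ-≤ 2 (loss-exponent-≤ u) ⟩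
    2 ^ (u * d + 8 * d)        ≡⟨ ^-distribˡ-+-* 2 (u * d) (8 * d) ⟩
    2 ^ (u * d) * 2 ^ (8 * d)  ≡⟨ cong (_* 2 ^ (8 * d)) (^-*-assoc 2 u d) ⟨
    k ^ d * 2 ^ (8 * d)        ≤⟨ *-monoˡ-≤ (2 ^ (8 * d)) (covering-subset-≥ A' A'⊆A A'+A≡A+A) ⟩
    ∣ A' ∣ * 2 ^ (8 * d)       ∎
    where open ≤-Reasoning

proposition5p7 : Σ ℕ λ c → 1 ≤ c × Σ ℕ λ N₀ → ∀ (N : ℕ) → N₀ ≤ N →
    Σ FinSetℤ λ A → ∣ A ∣ ≤ N × ∣ A +ˢ A ∣ ≤ 6 * ∣ A ∣ ×
    (∀ (A' : FinSetℤ) → A' ⊆ˢ A → SumsetEq A' A A A →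
    N ≤ ∣ A' ∣ * 2 ^ (c * ⌊√ ⌊log₂ N ⌋ ⌋))
proposition5p7 = 8 , s≤s z≤n , 2 ^ 25 , large
  where
  large : ∀ N → 2 ^ 25 ≤ N → SmallDoublingLargeCovers N (8 * ⌊√ ⌊log₂ N ⌋ ⌋)
  large N 2^25≤N = construction-at-scale N
    (m²≤n⇒m≤⌊√n⌋ (2^m≤n⇒m≤⌊log₂n⌋ 2^25≤N))
    (≤-trans (^-monoʳ-≤ 2 (⌊√n⌋²≤n L)) (2^⌊log₂n⌋≤n N {{>-nonZero (≤-trans (m^n>0 2 25) 2^25≤N)}}))
    (<-≤-trans (n<2^suc⌊log₂n⌋ N) (^-monoʳ-≤ 2 (n<[1+⌊√n⌋]² L)))
    where
    L = ⌊log₂ N ⌋
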